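{- Let $p,q$ be primes and $c,d\in\mathbb N$. Then $p:q::_m c:d$ holds if and only if either ($p=q$ and $c=d$) or ($p\neq q$ and $c=pu$ and $d=qu$ for some $u\in\mathbb N$), where $::_m$ is the monolinear analogical proportion relation in $(\mathbb N,\cdot,\mathbb N)$.
   Context: $(\mathbb N,\cdot,\mathbb N)$ is the algebra of natural numbers with multiplication and a constant symbol for every natural number. A justification is a pair of terms $s\to t$ with every variable of $t$ occurring in $s$; $\uparrow(a\to b)$ is the set of justifications with $a=s(\mathbf o)$, $b=t(\mathbf o)$ (evaluated in the algebra) for some assignment $\mathbf o$ of naturals to the variables. $\uparrow^m(a\to b)$ keeps those whose terms contain only a single fixed variable $x$, occurring at most once on each side. $\uparrow^m(a\to b:\!\cdot\,c\to d):=\uparrow^m(a\to b)\cap\uparrow^m(c\to d)$; a monolinear justification is trivial if it lies in all such sets. $a\to b:\!\cdot_m\,c\to d$ holds iff either (a) $\uparrow^m(a\to b)\cup\uparrow^m(c\to d)$ consists only of trivial justifications, or (b) with $J_e$ denoting $\uparrow^m(a\to b:\!\cdot\,c\to e)$ minus trivial justifications, $J_d\neq\emptyset$ and $J_d\subseteq J_{d'}$ implies $J_{d'}\subseteq J_d$ for every $d'\in\mathbb N$. Then $a:b::_m c:d$ iff $a\to b:\!\cdot_m\,c\to d$, $b\to a:\!\cdot_m\,d\to c$, $c\to d:\!\cdot_m\,a\to b$, $d\to c:\!\cdot_m\,b\to a$ all hold. -}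

module Defs where

open import Data.Nat using (ℕ; _*_; _+_; _≤_)
open import Data.Product using (Σ; ∃; _×_; _,_)
open import Data.Sum using (_⊎_)
open import Relation.Nullary using (¬_)
open import Relation.Binary.PropositionalEquality using (_≡_)

-- Terms of the algebra (ℕ, ·, ℕ) in the single fixed variable x:
-- the variable, a constant symbol for every natural number, and multiplication.
data Term : Set where
  var   : Term
  const : ℕ → Term
  _·_   : Term → Term → Term

eval : Term → ℕ → ℕ
eval var       o = o
eval (const n) o = n
eval (s · t)   o = eval s o * eval t o

occ : Term → ℕ
occ var       = 1
occ (const _) = 0
occ (s · t)   = occ s + occ t

record Just : Set where
  constructor _⇒_
  field
    lhs : Term
    rhs : Term
open Just public

-- monolinear: only the variable x, at most once on each side, and
-- every variable of rhs occurs in lhs (occ rhs ≤ occ lhs).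
Monolinear : Just → Set
Monolinear (s ⇒ t) = (occ s ≤ 1) × (occ t ≤ 1) × (occ t ≤ occ s)

UpM : ℕ → ℕ → Just → Set
UpM a b (s ⇒ t) = Monolinear (s ⇒ t) × ∃ λ o → (eval s o ≡ a) × (eval t o ≡ b)

UpM4 : ℕ → ℕ → ℕ → ℕ → Just → Set
UpM4 a b c d j = UpM a b j × UpM c d j

Trivial : Just → Set
Trivial j = Monolinear j × (∀ a b c d → UpM4 a b c d j)

Jset : ℕ → ℕ → ℕ → ℕ → Just → Set
Jset a b c e j = UpM4 a b c e j × ¬ Trivial j

_⊆J_ : (Just → Set) → (Just → Set) → Set
P ⊆J Q = ∀ j → P j → Q j

ArrowProp : ℕ → ℕ → ℕ → ℕ → Set
ArrowProp a b c d =
  (∀ j → (UpM a b j ⊎ UpM c d j) → Trivial j)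
  ⊎ ((∃ λ j → Jset a b c d j)
     × (∀ d′ → Jset a b c d ⊆J Jset a b c d′ → Jset a b c d′ ⊆J Jset a b c d))

Prop : ℕ → ℕ → ℕ → ℕ → Set
Prop a b c d =
  ArrowProp a b c d × ArrowProp b a d c × ArrowProp c d a b × ArrowProp d c b a

-- Every monolinear term t evaluates to eval t 1 · x ^ occ t, so a monolinear justification
-- is either constant on the right or of the shape k·x → l·x. Clause (a) of :·ₘ never holds,
-- so p → q :·ₘ c → d yields a justification common to p → q and c → d: either d = q, or
-- (p, q) = o (k, l) and (c, d) = o′ (k, l). Combined with the same for q → p :·ₘ d → c this
-- always produces such k, l, o, o′, and primality forces o ∈ {1, p}, i.e. c = p u, d = q u
-- (or c = d when p = q). Conversely k·x → l·x is non-trivial and, for k ≠ 0, determines d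
-- from c, which makes J_d minimal.
module Submission where

open import Defs
open import Data.Nat using (ℕ; zero; suc; _+_; _*_; _^_; _≤_; NonZero; ≢-nonZero⁻¹; z≤n; s≤s)
open import Data.Nat.Properties
open import Data.Nat.Divisibility using (divides)
open import Data.Nat.Primality using (Prime; prime⇒irreducible; prime⇒nonZero; ¬prime[1])
open import Algebra.Properties.CommutativeSemigroup *-commutativeSemigroup using (interchange)
open import Data.Product using (∃; _×_; _,_)
open import Data.Sum using (_⊎_; inj₁; inj₂)
open import Data.Empty using (⊥-elim)
open import Function.Bundles using (_⇔_; mk⇔)
open import Relation.Binary.PropositionalEquality
open import Relation.Nullary using (¬_; yes; no)

eval-homogeneous : ∀ t o → eval t o ≡ eval t 1 * o ^ occ t
eval-homogeneous var       o = sym (trans (*-identityˡ (o * 1)) (*-identityʳ o))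
eval-homogeneous (const n) o = sym (*-identityʳ n)
eval-homogeneous (s · t)   o = begin
  eval s o * eval t o
    ≡⟨ cong₂ _*_ (eval-homogeneous s o) (eval-homogeneous t o) ⟩
  eval s 1 * o ^ occ s * (eval t 1 * o ^ occ t)
    ≡⟨ interchange (eval s 1) (o ^ occ s) (eval t 1) (o ^ occ t) ⟩
  eval s 1 * eval t 1 * (o ^ occ s * o ^ occ t)
    ≡⟨ cong (eval s 1 * eval t 1 *_) (sym (^-distribˡ-+-* o (occ s) (occ t))) ⟩
  eval s 1 * eval t 1 * o ^ (occ s + occ t) ∎
  where open ≡-Reasoning

eval-constant : ∀ t → occ t ≡ 0 → ∀ o o′ → eval t o ≡ eval t o′
eval-constant t t0 o o′ = begin
  eval t o              ≡⟨ eval-homogeneous t o ⟩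
  eval t 1 * o ^ occ t  ≡⟨ cong (λ n → eval t 1 * o ^ n) t0 ⟩
  eval t 1 * 1          ≡⟨ cong (λ n → eval t 1 * o′ ^ n) (sym t0) ⟩
  eval t 1 * o′ ^ occ t ≡⟨ sym (eval-homogeneous t o′) ⟩
  eval t o′ ∎
  where open ≡-Reasoning

eval-linear : ∀ t → occ t ≡ 1 → ∀ o → eval t o ≡ eval t 1 * o
eval-linear t t1 o = begin
  eval t o             ≡⟨ eval-homogeneous t o ⟩
  eval t 1 * o ^ occ t ≡⟨ cong (λ n → eval t 1 * o ^ n) t1 ⟩
  eval t 1 * (o * 1)   ≡⟨ cong (eval t 1 *_) (*-identityʳ o) ⟩
  eval t 1 * o ∎
  where open ≡-Reasoning

-- The monolinear justification k·x → l·x, lying in ↑ᵐ(a → b) via x ↦ o and in ↑ᵐ(c → d) via x ↦ o′.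
record SameRatio (a b c d : ℕ) : Set where
  constructor sameRatio
  field
    k l o o′ : ℕ
    ko≡a     : k * o ≡ a
    lo≡b     : l * o ≡ b
    ko′≡c    : k * o′ ≡ c
    lo′≡d    : l * o′ ≡ d

module _ {a b c d : ℕ} where

  SameRatio-swap : SameRatio a b c d → SameRatio b a d c
  SameRatio-swap (sameRatio k l o o′ ko≡a lo≡b ko′≡c lo′≡d) =
    sameRatio l k o o′ lo≡b ko≡a lo′≡d ko′≡c

  SameRatio-flip : SameRatio a b c d → SameRatio c d a b
  SameRatio-flip (sameRatio k l o o′ ko≡a lo≡b ko′≡c lo′≡d) =
    sameRatio k l o′ o ko′≡c lo′≡d ko≡a lo≡b

SameRatio-refl : ∀ a b → SameRatio a b a b
SameRatio-refl a b = sameRatio a b 1 1 (*-identityʳ a) (*-identityʳ b) (*-identityʳ a) (*-identityʳ b)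

upM4⇒≡⊎SameRatio : ∀ {a b c d} j → UpM4 a b c d j → d ≡ b ⊎ SameRatio a b c d
upM4⇒≡⊎SameRatio (s ⇒ t) (((occs≤1 , occt≤1 , occt≤occs) , o , so≡a , to≡b) , (_ , o′ , so′≡c , to′≡d))
  with n≤1⇒n≡0∨n≡1 occt≤1
... | inj₁ occt≡0 = inj₁ (trans (sym to′≡d) (trans (eval-constant t occt≡0 o′ o) to≡b))
... | inj₂ occt≡1 = inj₂ (sameRatio (eval s 1) (eval t 1) o o′
        (trans (sym (eval-linear s occs≡1 o)) so≡a)  (trans (sym (eval-linear t occt≡1 o)) to≡b)
        (trans (sym (eval-linear s occs≡1 o′)) so′≡c) (trans (sym (eval-linear t occt≡1 o′)) to′≡d))
  where
  occs≡1 : occ s ≡ 1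
  occs≡1 = ≤-antisym occs≤1 (subst (_≤ occ s) occt≡1 occt≤occs)

-- Clause (a) never holds: const a → const b is in ↑ᵐ(a → b) but not in ↑ᵐ(a → b + 1).
arrowProp⇒∃upM4 : ∀ {a b c d} → ArrowProp a b c d → ∃ (UpM4 a b c d)
arrowProp⇒∃upM4 {a} {b} (inj₁ allTrivial)
  with allTrivial (const a ⇒ const b) (inj₁ ((z≤n , z≤n , z≤n) , 0 , refl , refl))
... | _ , inAll with inAll a (suc b) 0 0
...   | (_ , _ , _ , b≡1+b) , _ = ⊥-elim (1+n≢n (sym b≡1+b))
arrowProp⇒∃upM4 (inj₂ ((j , common , _) , _)) = j , common

arrowProps⇒SameRatio : ∀ {a b c d} → ArrowProp a b c d → ArrowProp b a d c → SameRatio a b c d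
arrowProps⇒SameRatio {a} {b} abcd badc
  with arrowProp⇒∃upM4 abcd | arrowProp⇒∃upM4 badc
... | j , jabcd | i , ibadc with upM4⇒≡⊎SameRatio j jabcd | upM4⇒≡⊎SameRatio i ibadc
...   | inj₂ r    | _         = r
...   | inj₁ _    | inj₂ r    = SameRatio-swap r
...   | inj₁ refl | inj₁ refl = SameRatio-refl a b

SameRatio-diagonal : ∀ {a c d} → .{{NonZero a}} → SameRatio a a c d → c ≡ d
SameRatio-diagonal {a} (sameRatio k l zero o′ ko≡a _ _ _) =
  ⊥-elim (≢-nonZero⁻¹ a (trans (sym ko≡a) (*-zeroʳ k)))
SameRatio-diagonal (sameRatio k l (suc o) o′ ko≡a lo≡a ko′≡c lo′≡d) = begin
  _       ≡⟨ sym ko′≡c ⟩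
  k * o′  ≡⟨ cong (_* o′) (*-cancelʳ-≡ k l (suc o) (trans ko≡a (sym lo≡a))) ⟩
  l * o′  ≡⟨ lo′≡d ⟩
  _ ∎
  where open ≡-Reasoning

-- o divides the prime p; o = p would make p divide the distinct prime q.
SameRatio-distinctPrimes : ∀ {p q c d} → Prime p → Prime q → p ≢ q → SameRatio p q c d →
  ∃ λ u → c ≡ p * u × d ≡ q * u
SameRatio-distinctPrimes pp pq p≢q (sameRatio k l o o′ ko≡p lo≡q ko′≡c lo′≡d)
  with prime⇒irreducible pp (divides k (sym ko≡p))
... | inj₁ refl = o′ , trans (sym ko′≡c) (cong (_* o′) (trans (sym (*-identityʳ k)) ko≡p))
                     , trans (sym lo′≡d) (cong (_* o′) (trans (sym (*-identityʳ l)) lo≡q))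
... | inj₂ refl with prime⇒irreducible pq (divides l (sym lo≡q))
...   | inj₁ refl = ⊥-elim (¬prime[1] pp)
...   | inj₂ p≡q  = ⊥-elim (p≢q p≡q)

linearJust : ℕ → ℕ → Just
linearJust k l = (const k · var) ⇒ (const l · var)

linearJust-monolinear : ∀ k l → Monolinear (linearJust k l)
linearJust-monolinear k l = s≤s z≤n , s≤s z≤n , s≤s z≤n

-- Membership in ↑ᵐ(1 → 0 :· 1 → 1) would force x ↦ 1 in both, hence l = 0 and l = 1.
linearJust-nontrivial : ∀ k l → ¬ Trivial (linearJust k l)
linearJust-nontrivial k l (_ , inAll) with inAll 1 0 1 1
... | (_ , o , ko≡1 , lo≡0) , (_ , o′ , ko′≡1 , lo′≡1) =
  0≢1+n (begin
    0      ≡⟨ sym lo≡0 ⟩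
    l * o  ≡⟨ cong (l *_) (trans (m*n≡1⇒n≡1 k o ko≡1) (sym (m*n≡1⇒n≡1 k o′ ko′≡1))) ⟩
    l * o′ ≡⟨ lo′≡1 ⟩
    1 ∎)
  where open ≡-Reasoning

module _ {a b c d : ℕ} (r : SameRatio a b c d) where
  open SameRatio r

  SameRatio⇒Jset : Jset a b c d (linearJust k l)
  SameRatio⇒Jset = ( (linearJust-monolinear k l , o , ko≡a , lo≡b)
                   , (linearJust-monolinear k l , o′ , ko′≡c , lo′≡d) )
                 , linearJust-nontrivial k l

  SameRatio⇒Jset-determines : .{{NonZero k}} → ∀ d′ → Jset a b c d′ (linearJust k l) → d′ ≡ d
  SameRatio⇒Jset-determines d′ ((_ , (_ , o″ , ko″≡c , lo″≡d′)) , _) =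
    trans (sym lo″≡d′) (trans (cong (l *_) (*-cancelˡ-≡ o″ o′ k (trans ko″≡c (sym ko′≡c)))) lo′≡d)

  SameRatio⇒ArrowProp : .{{NonZero k}} → ArrowProp a b c d
  SameRatio⇒ArrowProp = inj₂ ((linearJust k l , SameRatio⇒Jset) , minimal)
    where
    minimal : ∀ d′ → Jset a b c d ⊆J Jset a b c d′ → Jset a b c d′ ⊆J Jset a b c d
    minimal d′ Jd⊆Jd′ j j∈Jd′ = subst (λ e → Jset a b c e j)
      (SameRatio⇒Jset-determines d′ (Jd⊆Jd′ (linearJust k l) SameRatio⇒Jset)) j∈Jd′

SameRatio⇒Prop : ∀ {a b c d} (r : SameRatio a b c d) →
  let open SameRatio r in .{{NonZero k}} → .{{NonZero l}} → Prop a b c d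
SameRatio⇒Prop r = SameRatio⇒ArrowProp r
                 , SameRatio⇒ArrowProp (SameRatio-swap r)
                 , SameRatio⇒ArrowProp (SameRatio-flip r)
                 , SameRatio⇒ArrowProp (SameRatio-swap (SameRatio-flip r))

mainTheorem11 : (p q c d : ℕ) → Prime p → Prime q →
    Prop p q c d ⇔ ((p ≡ q × c ≡ d) ⊎ (p ≢ q × ∃ λ u → c ≡ p * u × d ≡ q * u))
mainTheorem11 p q c d pp pq = mk⇔ proportion⇒ ⇒proportion
  where
  instance
    _ = prime⇒nonZero pp
    _ = prime⇒nonZero pq

  proportion⇒ : Prop p q c d → (p ≡ q × c ≡ d) ⊎ (p ≢ q × ∃ λ u → c ≡ p * u × d ≡ q * u)
  proportion⇒ (pqcd , qpdc , _) with arrowProps⇒SameRatio pqcd qpdc | p ≟ q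
  ... | r | yes refl = inj₁ (refl , SameRatio-diagonal r)
  ... | r | no p≢q   = inj₂ (p≢q , SameRatio-distinctPrimes pp pq p≢q r)

  ⇒proportion : (p ≡ q × c ≡ d) ⊎ (p ≢ q × ∃ λ u → c ≡ p * u × d ≡ q * u) → Prop p q c d
  ⇒proportion (inj₁ (refl , refl)) =
    SameRatio⇒Prop (sameRatio 1 1 p c (*-identityˡ p) (*-identityˡ p) (*-identityˡ c) (*-identityˡ c))
  ⇒proportion (inj₂ (_ , u , refl , refl)) =
    SameRatio⇒Prop (sameRatio p q 1 u (*-identityʳ p) (*-identityʳ q) refl refl)
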